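{- Let $T$ be a semistandard Young tableau of shape $\lambda$ and content $\mu$, and let $\tau,\tau'$ be row-standard fillings of shape $\lambda$ and content $\mu$ with $\operatorname{st}(\tau)=\operatorname{st}(\tau')=T$. If $\tau$ and $\tau'$ have the same collection of entry-specific inversion pairs, then $\tau=\tau'$. That is, an inverted semistandard tableau is uniquely determined by its standardization together with its collection of inversion pairs, where each inversion pair records its column and which copies of the repeated values are involved.
   Context: Fillings use positive integers; content $\mu=(\mu_1,\dots,\mu_M)$ means exactly $\mu_v$ copies of $v$. Row-standard: strictly increasing along rows. Semistandard Young tableau: row-standard with weakly increasing columns. $\operatorname{st}(\tau)$ is obtained by sorting each column of $\tau$ into weakly increasing order top to bottom. Height order $\blacktriangleleft$ on the cells of each column of a row-standard filling, defined column by column from right to left: for cells $a_i,a_j$ in the same column, (i) if either lacks a cell directly to its right and $a_i$ is above $a_j$, then $a_i\blacktriangleleft a_j$; (ii) if $b_i,b_j$ are directly right of $a_i,a_j$ and $b_i<b_j$, then $a_i\blacktriangleleft a_j$; (iii) if $b_i=b_j$ and $b_i\blacktriangleleft b_j$, then $a_i\blacktriangleleft a_j$. For cells with entries $i<j$ in the same column, $(i,j)$ is an inversion pair iff $j\blacktriangleleft i$ (equivalently, with $i_k,j_k$ the entries $k$ boxes right: (1) $i_1$ or $j_1$ missing and $i$ below $j$; (2) $i_1>j_1$; (3) $i_k=j_k$ for $k\le n$, $i_{n+1}$ or $j_{n+1}$ missing, $i$ below $j$; (4) $i_k=j_k$ for $k\le n$ and $i_{n+1}>j_{n+1}$). In each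 column of a filling, the copies of each value $v$ are labelled $v_1,v_2,\dots$ in increasing height order (so in $T$ and in $\tau$ the $r$-th copy of $v$ in column $c$ correspond). An entry-specific inversion pair is the triple (column $c$, labelled smaller entry $i_r$, labelled larger entry $j_s$) of an inversion pair. -}

module Defs where

open import Data.Nat using (ℕ; zero; suc; _<_; _≤_; _≥_; _∸_; _<ᵇ_; _≡ᵇ_)
open import Data.Nat.Properties using (≤-decTotalOrder)
open import Data.Bool using (Bool; true; false; _∨_; _∧_)
open import Data.List using (List; []; _∷_; map; length; drop; upTo; filterᵇ; mapMaybe)
open import Data.List.Relation.Unary.All using (All)
open import Data.List.Relation.Unary.Linked using (Linked)
open import Data.Maybe using (Maybe; just; nothing; fromMaybe)
open import Data.Product using (_×_; ∃-syntax)
open import Relation.Binary.PropositionalEquality using (_≡_)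
open import Data.List.Sort ≤-decTotalOrder using (sort)
open import Data.Nat.ListAction using (sum)

-- A filling is a list of rows (top row first); row r, column c (0-indexed).
Filling : Set
Filling = List (List ℕ)

shape : Filling → List ℕ
shape = map length

IsPartition : List ℕ → Set
IsPartition λ′ = All (λ x → 1 ≤ x) λ′ × Linked _≥_ λ′

at : {A : Set} → List A → ℕ → Maybe A
at []       _       = nothing
at (x ∷ xs) zero    = just x
at (x ∷ xs) (suc n) = at xs n

rowOf : Filling → ℕ → List ℕ
rowOf τ r = fromMaybe [] (at τ r)

entry : Filling → ℕ → ℕ → Maybe ℕ
entry τ r c = at (rowOf τ r) c

Positive : Filling → Set
Positive τ = All (All (λ x → 1 ≤ x)) τ

RowStandard : Filling → Set
RowStandard τ = Positive τ × All (Linked _<_) τ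

IsSSYT : Filling → Set
IsSSYT τ = RowStandard τ ×
  (∀ r c x y → entry τ r c ≡ just x → entry τ (suc r) c ≡ just y → x ≤ y)

countV : ℕ → Filling → ℕ
countV v τ = sum (map (λ row → length (filterᵇ (λ x → v ≡ᵇ x) row)) τ)

-- content μ = (μ_1,…,μ_M) (stored as a list, μ_v at index v-1):
-- exactly μ_v copies of v for each v ≥ 1 (and none of v > M)
HasContent : Filling → List ℕ → Set
HasContent τ μ = Positive τ × (∀ v → 1 ≤ v → countV v τ ≡ fromMaybe 0 (at μ (v ∸ 1)))

column : Filling → ℕ → List ℕ
column τ c = mapMaybe (λ row → at row c) τ

stRows : Filling → ℕ → Filling → Filling
stRows τ r []           = []
stRows τ r (row ∷ rows) =
  map (λ c → fromMaybe 0 (at (sort (column τ c)) r)) (upTo (length row))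
  ∷ stRows τ (suc r) rows

st : Filling → Filling
st τ = stRows τ 0 τ

-- This is the recursive definition
-- (i)-(iii) unrolled: (i) if a right neighbour is missing, the upper cell is
-- smaller; (ii) smaller right neighbour ⇒ smaller; (iii) equal right
-- neighbours ⇒ compare the right neighbours in the height order.
rightLt : ℕ → ℕ → List ℕ → List ℕ → Bool
rightLt r₁ r₂ []       _        = r₁ <ᵇ r₂
rightLt r₁ r₂ (_ ∷ _)  []       = r₁ <ᵇ r₂
rightLt r₁ r₂ (x ∷ xs) (y ∷ ys) = (x <ᵇ y) ∨ ((x ≡ᵇ y) ∧ rightLt r₁ r₂ xs ys)

-- heightLt τ c r₁ r₂ = true  means  (r₁,c) ◀ (r₂,c)
heightLt : Filling → ℕ → ℕ → ℕ → Bool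
heightLt τ c r₁ r₂ = rightLt r₁ r₂ (drop (suc c) (rowOf τ r₁)) (drop (suc c) (rowOf τ r₂))

isJust≡ : Maybe ℕ → Maybe ℕ → Bool
isJust≡ (just x) (just y) = x ≡ᵇ y
isJust≡ _        _        = false

label : Filling → ℕ → ℕ → ℕ
label τ c r = suc (length (filterᵇ
  (λ r′ → isJust≡ (entry τ r′ c) (entry τ r c) ∧ heightLt τ c r′ r)
  (upTo (length τ))))

-- entry-specific inversion pair (column c, i_r, j_s):
-- cells with entries i < j in column c, with j ◀ i, labelled r and s
ESIP : Filling → ℕ → ℕ → ℕ → ℕ → ℕ → Set
ESIP τ c i r j s = ∃[ a ] ∃[ b ]
  (entry τ a c ≡ just i × entry τ b c ≡ just j × i < j ×
   heightLt τ c b a ≡ true × label τ c a ≡ r × label τ c b ≡ s)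

module Submission where

-- Columns are recovered from right to left: the height order on a
-- column only looks at the columns to its right, so suppose τ and τ′ agree there.
-- Then the two columns occupy the same cells, hold the same multiset (both sort
-- to the same column of the standardization) and are ordered by the same strict
-- total order ◁.  If they differ, let a be the ◁-least row where they do, with
-- i in τ and j > i in τ′.  Below a the columns agree, so in τ′ the copy of i
-- labelled like the one at a in τ lies in a row b with a ◁ b, and (i at b, j at a)
-- is an inversion of τ′.  Its counterpart in τ pairs the copy of i at a with a
-- copy of j below a carrying the label a has in τ′; but every copy of j below a
-- has a smaller label there, because below a the columns agree.

open import Defs
open import Data.Nat using (ℕ; zero; suc; _+_; _<_; _≤_; _≥_; _<ᵇ_; _≡ᵇ_; z≤n; s≤s; s≤s⁻¹; _<?_)
open import Data.Nat.Properties
open import Data.Nat.Induction using (<-wellFounded)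
open import Data.Bool using (Bool; true; false; _∧_; not; T)
open import Data.Bool.Properties using (∧-conicalˡ; ∧-conicalʳ; ∧-zeroʳ; ¬-not; T-≡; T-∧; T-∨)
  renaming (_≟_ to _≟ᵇ_)
open import Data.List using (List; []; _∷_; map; length; drop; upTo; applyUpTo; filterᵇ; catMaybes)
open import Data.List.Properties
  using (map-upTo; length-map; length-upTo; length-drop; length-catMaybes; ∷-injectiveˡ; ∷-injectiveʳ)
open import Data.List.Membership.Propositional using (_∈_)
open import Data.List.Membership.Propositional.Properties using (∈-upTo⁺; ∈-upTo⁻)
open import Data.List.Relation.Unary.Any using (here; there)
open import Data.List.Relation.Unary.Linked using (Linked)
import Data.List.Relation.Unary.Linked as Linked
open import Data.List.Relation.Binary.Permutation.Propositional
  using (_↭_; ↭-sym; ↭-trans; ↭-reflexive)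
open import Data.List.Relation.Binary.Permutation.Propositional.Properties
  using (↭-length; filter-↭)
open import Data.List.Sort ≤-decTotalOrder using (sort; sort-↭)
open import Data.Maybe using (Maybe; just; nothing; fromMaybe; maybe′)
open import Data.Maybe.Properties using (just-injective)
open import Data.Product using (_×_; _,_; ∃-syntax)
open import Data.Sum using (_⊎_; inj₁; inj₂) renaming (map to ⊎-map)
open import Data.Empty using (⊥; ⊥-elim)
open import Function using (_∘_; id)
open import Function.Bundles using (_⇔_; mk⇔; Equivalence)
open import Induction.WellFounded using (WellFounded; Acc; acc; module Subrelation; module All)
open import Relation.Binary using (tri<; tri≈; tri>)
import Relation.Binary.Construct.On as On
open import Relation.Binary.PropositionalEquality
open import Relation.Nullary using (¬_; yes; no; contradiction)
open import Relation.Nullary.Decidable using (T?)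

count : {A : Set} → (A → Bool) → List A → ℕ
count p xs = length (filterᵇ p xs)

module _ {A : Set} where

  count-mono : ∀ (p q : A → Bool) xs → (∀ y → y ∈ xs → p y ≡ true → q y ≡ true) →
               count p xs ≤ count q xs
  count-mono p q []       _   = z≤n
  count-mono p q (x ∷ xs) p⇒q with p x in px | q x in qx | count-mono p q xs (λ y → p⇒q y ∘ there)
  ... | true  | true  | ih = s≤s ih
  ... | true  | false | _  = contradiction (trans (sym (p⇒q x (here refl) px)) qx) λ ()
  ... | false | true  | ih = m≤n⇒m≤1+n ih
  ... | false | false | ih = ih

  count-mono-< : ∀ (p q : A → Bool) xs → (∀ y → y ∈ xs → p y ≡ true → q y ≡ true) →
                 ∀ {y} → y ∈ xs → q y ≡ true → p y ≡ false → count p xs < count q xs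
  count-mono-< p q (x ∷ xs) p⇒q (here refl) qx px rewrite px | qx =
    s≤s (count-mono p q xs (λ y → p⇒q y ∘ there))
  count-mono-< p q (x ∷ xs) p⇒q (there y∈) qy py
    with p x in px | q x in qx | count-mono-< p q xs (λ y → p⇒q y ∘ there) y∈ qy py
  ... | true  | true  | ih = s≤s ih
  ... | true  | false | _  = contradiction (trans (sym (p⇒q x (here refl) px)) qx) λ ()
  ... | false | true  | ih = m≤n⇒m≤1+n ih
  ... | false | false | ih = ih

  count-cong : ∀ (p q : A → Bool) xs → (∀ y → y ∈ xs → p y ≡ q y) → count p xs ≡ count q xs
  count-cong p q xs p≗q = ≤-antisym (count-mono p q xs λ y y∈ → trans (sym (p≗q y y∈)))
                                    (count-mono q p xs λ y y∈ → trans (p≗q y y∈))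

  count-map : ∀ {B : Set} (p : B → Bool) (f : A → B) xs → count p (map f xs) ≡ count (p ∘ f) xs
  count-map p f []       = refl
  count-map p f (x ∷ xs) with p (f x)
  ... | true  = cong suc (count-map p f xs)
  ... | false = count-map p f xs

  count-false : ∀ (xs : List A) → count (λ _ → false) xs ≡ 0
  count-false []       = refl
  count-false (_ ∷ xs) = count-false xs

  count-↭ : ∀ (p : A → Bool) {xs ys} → xs ↭ ys → count p xs ≡ count p ys
  count-↭ p xs↭ys = ↭-length (filter-↭ (T? ∘ p) xs↭ys)

downward-induction : ∀ (P : ℕ → Set) B → (∀ c → B ≤ c → P c) →
                     (∀ c → (∀ c′ → c < c′ → P c′) → P c) → ∀ c → P c
downward-induction P B beyond step c = go B c (m≤m+n B c)
  where
  go : ∀ d c → B ≤ d + c → P c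
  go zero    c B≤c = beyond c B≤c
  go (suc d) c B≤d+1+c = step c λ c′ c<c′ →
    go d c′ (≤-trans B≤d+1+c (≤-trans (≤-reflexive (sym (+-suc d c))) (+-monoʳ-≤ d c<c′)))

at-≥ : ∀ {A : Set} (xs : List A) {n} → length xs ≤ n → at xs n ≡ nothing
at-≥ []       _       = refl
at-≥ (x ∷ xs) {suc n} (s≤s l) = at-≥ xs l

at≡nothing⇒≥ : ∀ {A : Set} (xs : List A) n → at xs n ≡ nothing → length xs ≤ n
at≡nothing⇒≥ []       n       _  = z≤n
at≡nothing⇒≥ (x ∷ xs) (suc n) eq = s≤s (at≡nothing⇒≥ xs n eq)

at-< : ∀ {A : Set} (xs : List A) {n} → n < length xs → ∃[ x ] at xs n ≡ just x
at-< (x ∷ xs) {zero}  _       = x , refl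
at-< (x ∷ xs) {suc n} (s≤s l) = at-< xs l

at-ext : ∀ {A : Set} (xs ys : List A) → (∀ n → at xs n ≡ at ys n) → xs ≡ ys
at-ext []       []       _  = refl
at-ext []       (y ∷ ys) eq with () ← eq 0
at-ext (x ∷ xs) []       eq with () ← eq 0
at-ext (x ∷ xs) (y ∷ ys) eq = cong₂ _∷_ (just-injective (eq 0)) (at-ext xs ys (eq ∘ suc))

at-drop : ∀ {A : Set} k (xs : List A) n → at (drop k xs) n ≡ at xs (k + n)
at-drop zero    xs       n = refl
at-drop (suc k) []       n = refl
at-drop (suc k) (x ∷ xs) n = at-drop k xs n

at≡nothing-resp-length : ∀ {A : Set} (xs ys : List A) n → length xs ≡ length ys →
                         at xs n ≡ nothing → at ys n ≡ nothing
at≡nothing-resp-length xs ys n eq e =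
  at-≥ ys (subst (_≤ n) eq (at≡nothing⇒≥ xs n e))

at-applyUpTo : ∀ {A : Set} (f : ℕ → A) {m c} → c < m → at (applyUpTo f m) c ≡ just (f c)
at-applyUpTo f {suc m} {zero}  _       = refl
at-applyUpTo f {suc m} {suc c} (s≤s l) = at-applyUpTo (f ∘ suc) l

at-fromMaybe : ∀ {A : Set} {d : A} xs {r} → r < length xs → just (fromMaybe d (at xs r)) ≡ at xs r
at-fromMaybe xs r<ℓ with at-< xs r<ℓ
... | _ , e rewrite e = refl

drop-≡ : ∀ {A : Set} k (xs ys : List A) → (∀ m → at xs (k + m) ≡ at ys (k + m)) →
         drop k xs ≡ drop k ys
drop-≡ k xs ys eq = at-ext _ _ λ m → trans (at-drop k xs m) (trans (eq m) (sym (at-drop k ys m)))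

count-applyUpTo-suc : ∀ (p : ℕ → Bool) n → count p (applyUpTo suc n) ≡ count (p ∘ suc) (upTo n)
count-applyUpTo-suc p n = trans (cong (count p) (sym (map-upTo suc n))) (count-map p suc (upTo n))

count-at : ∀ v xs {n} → length xs ≤ n →
           count (λ y → isJust≡ (at xs y) (just v)) (upTo n) ≡ count (_≡ᵇ v) xs
count-at v []       {n}     _       = count-false (upTo n)
count-at v (x ∷ xs) {suc n} (s≤s l)
  with x ≡ᵇ v | trans (count-applyUpTo-suc _ n) (count-at v xs l)
... | true  | ih = cong suc ih
... | false | ih = ih

-- Columns ordered by a strict total order on the rows

isJust≡-sound : ∀ m {v} → isJust≡ m (just v) ≡ true → m ≡ just v
isJust≡-sound (just w) {v} eq = cong just (≡ᵇ⇒≡ w v (Equivalence.from T-≡ eq))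

isJust≡-refl : ∀ v → isJust≡ (just v) (just v) ≡ true
isJust≡-refl v = Equivalence.to T-≡ (≡⇒≡ᵇ v v refl)

not≡true : ∀ {b} → not b ≡ true → b ≡ false
not≡true {false} _ = refl

not≡false : ∀ {b} → not b ≡ false → b ≡ true
not≡false {true} _ = refl

Copies : (ℕ → Maybe ℕ) → ℕ → ℕ → Bool
Copies h v y = isJust≡ (h y) (just v)

Copies-just : ∀ h {v x} → h x ≡ just v → Copies h v x ≡ true
Copies-just h {v} eq rewrite eq = isJust≡-refl v

columnLabel : ℕ → (ℕ → ℕ → Bool) → (ℕ → Maybe ℕ) → ℕ → ℕ
columnLabel n _◁_ h x = suc (count (λ y → isJust≡ (h y) (h x) ∧ y ◁ x) (upTo n))

-- ESIP τ c unfolds to ColumnInversion (length τ) (heightLt τ c) (λ r → entry τ r c).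
ColumnInversion : ℕ → (ℕ → ℕ → Bool) → (ℕ → Maybe ℕ) → ℕ → ℕ → ℕ → ℕ → Set
ColumnInversion n _◁_ h i r j s = ∃[ a ] ∃[ b ]
  (h a ≡ just i × h b ≡ just j × i < j × b ◁ a ≡ true ×
   columnLabel n _◁_ h a ≡ r × columnLabel n _◁_ h b ≡ s)

ColumnInversion-resp : ∀ {n n′ _◁_ _◁′_} h → n ≡ n′ → (∀ x y → x ◁ y ≡ x ◁′ y) →
  ∀ {i r j s} → ColumnInversion n _◁_ h i r j s → ColumnInversion n′ _◁′_ h i r j s
ColumnInversion-resp {n} {_◁_ = _◁_} {_◁′_} h refl ◁≗◁′ (a , b , ha , hb , i<j , b◁a , la , lb) =
  a , b , ha , hb , i<j , trans (sym (◁≗◁′ b a)) b◁a ,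
  trans (sym (label≗ a)) la , trans (sym (label≗ b)) lb
  where
  label≗ : ∀ x → columnLabel n _◁_ h x ≡ columnLabel n _◁′_ h x
  label≗ x = cong suc (count-cong _ _ (upTo n) λ y _ → cong (isJust≡ (h y) (h x) ∧_) (◁≗◁′ y x))

module RowOrder (n : ℕ) (_◁_ : ℕ → ℕ → Bool)
  (◁-trans : ∀ {x y z} → x ◁ y ≡ true → y ◁ z ≡ true → x ◁ z ≡ true)
  (◁-irrefl : ∀ x → x ◁ x ≡ false)
  (◁-total : ∀ {x y} → x ≢ y → x ◁ y ≡ true ⊎ y ◁ x ≡ true) where

  _⊏_ : ℕ → ℕ → Set
  y ⊏ a = y < n × y ◁ a ≡ true

  below : (ℕ → Bool) → ℕ → ℕ
  below p a = count (λ y → p y ∧ y ◁ a) (upTo n)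

  below-mono : ∀ (p : ℕ → Bool) {x z} → x < n → p x ≡ true → x ◁ z ≡ true → below p x < below p z
  below-mono p {x} x<n px x◁z = count-mono-< _ _ (upTo n)
    (λ y _ e → cong₂ _∧_ (∧-conicalˡ (p y) _ e) (◁-trans (∧-conicalʳ (p y) _ e) x◁z))
    (∈-upTo⁺ x<n) (cong₂ _∧_ px x◁z) (trans (cong (p x ∧_) (◁-irrefl x)) (∧-zeroʳ (p x)))

  below<count : ∀ (p : ℕ → Bool) {x} → x < n → p x ≡ true → below p x < count p (upTo n)
  below<count p {x} x<n px = count-mono-< _ _ (upTo n) (λ y _ → ∧-conicalˡ (p y) _)
    (∈-upTo⁺ x<n) px (trans (cong (p x ∧_) (◁-irrefl x)) (∧-zeroʳ (p x)))

  below-injective : ∀ (p : ℕ → Bool) {x z} → x < n → z < n → p x ≡ true → p z ≡ true →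
                    below p x ≡ below p z → x ≡ z
  below-injective p {x} {z} x<n z<n px pz eq with x ≟ z
  ... | yes x≡z = x≡z
  ... | no x≢z with ◁-total x≢z
  ...   | inj₁ x◁z = contradiction eq (<⇒≢ (below-mono p x<n px x◁z))
  ...   | inj₂ z◁x = contradiction (sym eq) (<⇒≢ (below-mono p z<n pz z◁x))

  below-cong : ∀ {p q : ℕ → Bool} a → (∀ y → y ⊏ a → p y ≡ q y) → below p a ≡ below q a
  below-cong {p} {q} a p≗q = count-cong _ _ (upTo n) λ y y∈ → agree y (∈-upTo⁻ y∈)
    where
    agree : ∀ y → y < n → (p y ∧ y ◁ a) ≡ (q y ∧ y ◁ a)
    agree y y<n with y ◁ a in y◁a
    ... | true  = cong (_∧ true) (p≗q y (y<n , y◁a))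
    ... | false = trans (∧-zeroʳ (p y)) (sym (∧-zeroʳ (q y)))

  ⊏-wellFounded : WellFounded _⊏_
  ⊏-wellFounded = Subrelation.wellFounded (λ (y<n , y◁a) → below-mono (λ _ → true) y<n refl y◁a)
                    (On.wellFounded (below (λ _ → true)) <-wellFounded)

  minimal : ∀ (p : ℕ → Bool) {x} → p x ≡ true → ∃[ m ] (p m ≡ true × ∀ y → y ⊏ m → p y ≡ false)
  minimal p px = go px (⊏-wellFounded _)
    where
    go : ∀ {x} → p x ≡ true → Acc _⊏_ x → ∃[ m ] (p m ≡ true × ∀ y → y ⊏ m → p y ≡ false)
    go {x} px (acc rec) with anyUpTo? (λ y → p y ∧ y ◁ x ≟ᵇ true) n
    ... | yes (y , y<n , e) = go (∧-conicalˡ (p y) _ e) (rec (y<n , ∧-conicalʳ (p y) _ e))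
    ... | no none = x , px , λ y (y<n , y◁x) → ¬-not λ py → none (y , y<n , cong₂ _∧_ py y◁x)

  copyLabel : (ℕ → Maybe ℕ) → ℕ → ℕ
  copyLabel = columnLabel n _◁_

  Inversion : (ℕ → Maybe ℕ) → ℕ → ℕ → ℕ → ℕ → Set
  Inversion = ColumnInversion n _◁_

  copyLabel-just : ∀ h {x v} → h x ≡ just v → copyLabel h x ≡ suc (below (Copies h v) x)
  copyLabel-just h eq rewrite eq = refl

  module FirstDifference {f g : ℕ → Maybe ℕ}
    (f-bounded : ∀ {y v} → f y ≡ just v → y < n)
    (same-count : ∀ v → count (Copies f v) (upTo n) ≡ count (Copies g v) (upTo n))
    (g⇒f : ∀ {i r j s} → Inversion g i r j s → Inversion f i r j s)
    {a i j : ℕ} (fa : f a ≡ just i) (ga : g a ≡ just j) (i<j : i < j)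
    (agree : ∀ {y} → y ⊏ a → f y ≡ g y) where

    below-a-agrees : ∀ v → below (Copies f v) a ≡ below (Copies g v) a
    below-a-agrees v = below-cong a λ y y⊏a → cong (λ m → isJust≡ m (just v)) (agree y⊏a)

    i-outside : ∃[ y ] ((Copies g i y ∧ not (y ◁ a)) ≡ true)
    i-outside with anyUpTo? (λ y → Copies g i y ∧ not (y ◁ a) ≟ᵇ true) n
    ... | yes (y , _ , e) = y , e
    ... | no none = contradiction (begin-strict
          count (Copies g i) (upTo n) ≤⟨ count-mono _ _ (upTo n) copy-below-a ⟩
          below (Copies g i) a        ≡⟨ below-a-agrees i ⟨
          below (Copies f i) a
            <⟨ below<count (Copies f i) (f-bounded fa) (Copies-just f fa) ⟩
          count (Copies f i) (upTo n) ≡⟨ same-count i ⟩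
          count (Copies g i) (upTo n) ∎) (<-irrefl refl)
      where
      open ≤-Reasoning
      copy-below-a : ∀ y → y ∈ upTo n → Copies g i y ≡ true → (Copies g i y ∧ y ◁ a) ≡ true
      copy-below-a y y∈ c =
        cong₂ _∧_ c (not≡false (¬-not λ e → none (y , ∈-upTo⁻ y∈ , cong₂ _∧_ c e)))

    lowest-i-outside : ∃[ b ] (g b ≡ just i × b ◁ a ≡ false ×
                               ∀ y → y ⊏ b → Copies g i y ≡ true → y ◁ a ≡ true)
    lowest-i-outside with i-outside
    ... | _ , e with minimal (λ z → Copies g i z ∧ not (z ◁ a)) e
    ...   | b , pb , lowest =
      b , isJust≡-sound (g b) (∧-conicalˡ _ _ pb) , not≡true (∧-conicalʳ (Copies g i b) _ pb) ,
      λ y y⊏b c → not≡false (trans (sym (cong (_∧ not (y ◁ a)) c)) (lowest y y⊏b))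

    module _ {b} (gb : g b ≡ just i) (b⋪a : b ◁ a ≡ false)
             (lowest : ∀ y → y ⊏ b → Copies g i y ≡ true → y ◁ a ≡ true) where

      a≢b : a ≢ b
      a≢b refl = <⇒≢ i<j (just-injective (trans (sym gb) ga))

      a◁b : a ◁ b ≡ true
      a◁b with ◁-total a≢b
      ... | inj₁ a◁b = a◁b
      ... | inj₂ b◁a = contradiction (trans (sym b◁a) b⋪a) λ ()

      copies-below-b : below (Copies g i) b ≡ below (Copies g i) a
      copies-below-b = count-cong _ _ (upTo n) λ y y∈ → same y (∈-upTo⁻ y∈)
        where
        same : ∀ y → y < n → (Copies g i y ∧ y ◁ b) ≡ (Copies g i y ∧ y ◁ a)
        same y y<n with Copies g i y in c | y ◁ a in y◁a
        ... | false | _     = refl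
        ... | true  | true  = ◁-trans y◁a a◁b
        ... | true  | false =
          ¬-not λ y◁b → contradiction (trans (sym y◁a) (lowest y (y<n , y◁b) c)) λ ()

      g-inversion : Inversion g i (copyLabel f a) j (copyLabel g a)
      g-inversion = b , a , gb , ga , i<j , a◁b , b-label , refl
        where
        open ≡-Reasoning
        b-label : copyLabel g b ≡ copyLabel f a
        b-label = begin
          copyLabel g b                ≡⟨ copyLabel-just g gb ⟩
          suc (below (Copies g i) b)   ≡⟨ cong suc copies-below-b ⟩
          suc (below (Copies g i) a)   ≡⟨ cong suc (below-a-agrees i) ⟨
          suc (below (Copies f i) a)   ≡⟨ copyLabel-just f fa ⟨
          copyLabel f a                ∎

    no-f-inversion : ¬ Inversion f i (copyLabel f a) j (copyLabel g a)
    no-f-inversion (a′ , b′ , fa′ , fb′ , _ , b′◁a′ , a′-label , b′-label) =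
      <-irrefl b′-label (begin-strict
        copyLabel f b′                ≡⟨ copyLabel-just f fb′ ⟩
        suc (below (Copies f j) b′)
          <⟨ s≤s (below-mono (Copies f j) (f-bounded fb′) (Copies-just f fb′) b′◁a) ⟩
        suc (below (Copies f j) a)    ≡⟨ cong suc (below-a-agrees j) ⟩
        suc (below (Copies g j) a)    ≡⟨ copyLabel-just g ga ⟨
        copyLabel g a                 ∎)
      where
      open ≤-Reasoning
      a′≡a : a′ ≡ a
      a′≡a = below-injective (Copies f i) (f-bounded fa′) (f-bounded fa)
        (Copies-just f fa′) (Copies-just f fa)
        (suc-injective (trans (sym (copyLabel-just f fa′)) (trans a′-label (copyLabel-just f fa))))
      b′◁a : b′ ◁ a ≡ true
      b′◁a = subst (λ x → b′ ◁ x ≡ true) a′≡a b′◁a′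

    impossible : ⊥
    impossible with lowest-i-outside
    ... | _ , gb , b⋪a , lowest = no-f-inversion (g⇒f (g-inversion gb b⋪a lowest))

  column-determined : ∀ {f g : ℕ → Maybe ℕ} →
    (∀ {y v} → f y ≡ just v → y < n) →
    (∀ y → f y ≡ nothing ⇔ g y ≡ nothing) →
    (∀ v → count (Copies f v) (upTo n) ≡ count (Copies g v) (upTo n)) →
    (∀ i r j s → Inversion f i r j s ⇔ Inversion g i r j s) →
    ∀ y → f y ≡ g y
  column-determined {f} {g} f-bounded same-support same-count same-inversions =
    All.wfRec ⊏-wellFounded _ (λ a → f a ≡ g a) agree-at
    where
    open Equivalence
    g-bounded : ∀ {y v} → g y ≡ just v → y < n
    g-bounded {y} gy with f y in fy
    ... | just _  = f-bounded fy
    ... | nothing = contradiction (trans (sym gy) (to (same-support y) fy)) λ ()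
    agree-at : ∀ a → (∀ {y} → y ⊏ a → f y ≡ g y) → f a ≡ g a
    agree-at a agree with f a in fa | g a in ga
    ... | nothing | nothing = refl
    ... | nothing | just _  = contradiction (trans (sym ga) (to (same-support a) fa)) λ ()
    ... | just _  | nothing = contradiction (trans (sym fa) (from (same-support a) ga)) λ ()
    ... | just i  | just j  with <-cmp i j
    ...   | tri< i<j _ _ = ⊥-elim (FirstDifference.impossible
                              f-bounded same-count (from (same-inversions _ _ _ _)) fa ga i<j agree)
    ...   | tri≈ _ i≡j _ = cong just i≡j
    ...   | tri> _ _ j<i = ⊥-elim (FirstDifference.impossible
                              g-bounded (sym ∘ same-count) (to (same-inversions _ _ _ _)) ga fa j<i
                              (sym ∘ agree))

-- Fillings and the height order

rowLength-antitone : ∀ τ → Linked _≥_ (shape τ) → ∀ {r r′} → r ≤ r′ →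
                     length (rowOf τ r′) ≤ length (rowOf τ r)
rowLength-antitone []           _ _ = z≤n
rowLength-antitone (row ∷ rest) _ {zero}  {zero}   _          = ≤-refl
rowLength-antitone (row ∷ rest) L {suc r} {suc r′} (s≤s r≤r′) =
  rowLength-antitone rest (Linked.tail L) r≤r′
rowLength-antitone (row ∷ rest) L {zero}  {suc r′} _          =
  ≤-trans (rowLength-antitone rest (Linked.tail L) z≤n) (second≤first rest L)
  where
  second≤first : ∀ rest → Linked _≥_ (length row ∷ shape rest) → length (rowOf rest 0) ≤ length row
  second≤first []      _ = z≤n
  second≤first (_ ∷ _) L = Linked.head L

length-≡ : ∀ {τ τ′ : Filling} → shape τ ≡ shape τ′ → length τ ≡ length τ′
length-≡ {τ} {τ′} eq =
  trans (sym (length-map length τ)) (trans (cong length eq) (length-map length τ′))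

rowOf-length-≡ : ∀ {τ τ′} → shape τ ≡ shape τ′ → ∀ r → length (rowOf τ r) ≡ length (rowOf τ′ r)
rowOf-length-≡ {[]}    {[]}     _  _       = refl
rowOf-length-≡ {_ ∷ _} {_ ∷ _}  eq zero    = ∷-injectiveˡ eq
rowOf-length-≡ {_ ∷ _} {_ ∷ _}  eq (suc r) = rowOf-length-≡ (∷-injectiveʳ eq) r

entry-just⇒< : ∀ τ {r c v} → entry τ r c ≡ just v → r < length τ
entry-just⇒< (_ ∷ _) {zero}  _ = s≤s z≤n
entry-just⇒< (_ ∷ τ) {suc r} e = s≤s (entry-just⇒< τ e)

filling-ext : ∀ {τ τ′ : Filling} → length τ ≡ length τ′ →
              (∀ r c → entry τ r c ≡ entry τ′ r c) → τ ≡ τ′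
filling-ext {[]}    {[]}    _ _  = refl
filling-ext {_ ∷ _} {_ ∷ _} l eq =
  cong₂ _∷_ (at-ext _ _ (eq 0)) (filling-ext (suc-injective l) (eq ∘ suc))

rightLt-∷⁻ : ∀ {a b} x X y Y → T (rightLt a b (x ∷ X) (y ∷ Y)) →
             x < y ⊎ (x ≡ y × T (rightLt a b X Y))
rightLt-∷⁻ x X y Y p with Equivalence.to T-∨ p
... | inj₁ x<y = inj₁ (<ᵇ⇒< x y x<y)
... | inj₂ q   = let (x≡y , r) = Equivalence.to T-∧ q in inj₂ (≡ᵇ⇒≡ x y x≡y , r)

rightLt-∷⁺ : ∀ {a b} x X y Y → x < y ⊎ (x ≡ y × T (rightLt a b X Y)) →
             T (rightLt a b (x ∷ X) (y ∷ Y))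
rightLt-∷⁺ x X y Y (inj₁ x<y)            = Equivalence.from T-∨ (inj₁ (<⇒<ᵇ x<y))
rightLt-∷⁺ x X _ Y (inj₂ (refl , r))   =
  Equivalence.from T-∨ (inj₂ (Equivalence.from T-∧ (≡⇒≡ᵇ x x refl , r)))

<ᵇ-trans : ∀ a b c → T (a <ᵇ b) → T (b <ᵇ c) → T (a <ᵇ c)
<ᵇ-trans a b c p q = <⇒<ᵇ (<-trans (<ᵇ⇒< a b p) (<ᵇ⇒< b c q))

LengthAntitone : ℕ → List ℕ → ℕ → List ℕ → Set
LengthAntitone a X b Y = a ≤ b → length Y ≤ length X

-- The length conditions rule out the cases where one comparison falls back to the
-- row indices and the other does not.
rightLt-trans : ∀ {a b c} X Y Z →
  LengthAntitone a X b Y → LengthAntitone b Y c Z → LengthAntitone c Z a X →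
  T (rightLt a b X Y) → T (rightLt b c Y Z) → T (rightLt a c X Z)
rightLt-trans {a} {b} {c} [] [] _ _ _ _ p q = <ᵇ-trans a b c p q
rightLt-trans {a} {b} []      (_ ∷ _) _       ab _  _  p _ with () ← ab (<⇒≤ (<ᵇ⇒< a b p))
rightLt-trans {a} {b} {c} (_ ∷ _) [] [] _ _ _ p q = <ᵇ-trans a b c p q
rightLt-trans {b = b} {c} (_ ∷ _) [] (_ ∷ _) _ bc _ _ q with () ← bc (<⇒≤ (<ᵇ⇒< b c q))
rightLt-trans (_ ∷ _) (_ ∷ _) []      _  _  ca _ _ = <⇒<ᵇ (≰⇒> λ c≤a → contradiction (ca c≤a) λ ())
rightLt-trans (x ∷ X) (y ∷ Y) (z ∷ Z) ab bc ca p q with rightLt-∷⁻ x X y Y p | rightLt-∷⁻ y Y z Z q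
... | inj₁ x<y        | inj₁ y<z         = rightLt-∷⁺ x X z Z (inj₁ (<-trans x<y y<z))
... | inj₁ x<y        | inj₂ (refl , _)  = rightLt-∷⁺ x X z Z (inj₁ x<y)
... | inj₂ (refl , _) | inj₁ y<z         = rightLt-∷⁺ x X z Z (inj₁ y<z)
... | inj₂ (refl , r) | inj₂ (refl , r′) = rightLt-∷⁺ x X z Z (inj₂ (refl ,
  rightLt-trans X Y Z (s≤s⁻¹ ∘ ab) (s≤s⁻¹ ∘ bc) (s≤s⁻¹ ∘ ca) r r′))

rightLt-irrefl : ∀ a X → ¬ T (rightLt a a X X)
rightLt-irrefl a []      p = <-irrefl refl (<ᵇ⇒< a a p)
rightLt-irrefl a (x ∷ X) p with rightLt-∷⁻ x X x X p
... | inj₁ x<x      = <-irrefl refl x<x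
... | inj₂ (_ , q)  = rightLt-irrefl a X q

<ᵇ-total : ∀ {a b} → a ≢ b → T (a <ᵇ b) ⊎ T (b <ᵇ a)
<ᵇ-total {a} {b} a≢b with <-cmp a b
... | tri< a<b _ _ = inj₁ (<⇒<ᵇ a<b)
... | tri≈ _ a≡b _ = contradiction a≡b a≢b
... | tri> _ _ b<a = inj₂ (<⇒<ᵇ b<a)

rightLt-total : ∀ {a b} X Y → a ≢ b → T (rightLt a b X Y) ⊎ T (rightLt b a Y X)
rightLt-total []      []      a≢b = <ᵇ-total a≢b
rightLt-total []      (_ ∷ _) a≢b = <ᵇ-total a≢b
rightLt-total (_ ∷ _) []      a≢b = <ᵇ-total a≢b
rightLt-total (x ∷ X) (y ∷ Y) a≢b with <-cmp x y
... | tri< x<y _ _ = inj₁ (rightLt-∷⁺ x X y Y (inj₁ x<y))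
... | tri> _ _ y<x = inj₂ (rightLt-∷⁺ y Y x X (inj₁ y<x))
... | tri≈ _ refl _ with rightLt-total X Y a≢b
...   | inj₁ r = inj₁ (rightLt-∷⁺ x X x Y (inj₂ (refl , r)))
...   | inj₂ r = inj₂ (rightLt-∷⁺ x Y x X (inj₂ (refl , r)))

module HeightOrder (τ : Filling) (antitone : Linked _≥_ (shape τ)) (c : ℕ) where

  private
    right : ℕ → List ℕ
    right r = drop (suc c) (rowOf τ r)

    right-antitone : ∀ x y → LengthAntitone x (right x) y (right y)
    right-antitone x y x≤y
      rewrite length-drop (suc c) (rowOf τ y) | length-drop (suc c) (rowOf τ x) =
      ∸-monoˡ-≤ (suc c) (rowLength-antitone τ antitone x≤y)

  open Equivalence

  heightLt-trans : ∀ {x y z} → heightLt τ c x y ≡ true → heightLt τ c y z ≡ true →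
                   heightLt τ c x z ≡ true
  heightLt-trans {x} {y} {z} p q = to T-≡ (rightLt-trans (right x) (right y) (right z)
    (right-antitone x y) (right-antitone y z) (right-antitone z x) (from T-≡ p) (from T-≡ q))

  heightLt-irrefl : ∀ x → heightLt τ c x x ≡ false
  heightLt-irrefl x = ¬-not (rightLt-irrefl x (right x) ∘ from T-≡)

  heightLt-total : ∀ {x y} → x ≢ y → heightLt τ c x y ≡ true ⊎ heightLt τ c y x ≡ true
  heightLt-total {x} {y} x≢y = ⊎-map (to T-≡) (to T-≡) (rightLt-total (right x) (right y) x≢y)

heightLt-cong : ∀ τ τ′ c → (∀ r → drop (suc c) (rowOf τ r) ≡ drop (suc c) (rowOf τ′ r)) →
                ∀ x y → heightLt τ c x y ≡ heightLt τ′ c x y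
heightLt-cong τ τ′ c same-right x y = cong₂ (rightLt x y) (same-right x) (same-right y)

at-column : ∀ τ → Linked _≥_ (shape τ) → ∀ c r → at (column τ c) r ≡ entry τ r c
at-column []           _ c r = refl
at-column (row ∷ rest) L c r = go (at row c) refl r
  where
  below-first : ∀ {r} → length row ≤ c → entry (row ∷ rest) r c ≡ nothing
  below-first {r} row≤c =
    at-≥ (rowOf (row ∷ rest) r) (≤-trans (rowLength-antitone (row ∷ rest) L {0} {r} z≤n) row≤c)
  go : ∀ m → at row c ≡ m → ∀ r → at (maybe′ _∷_ id m (column rest c)) r ≡ entry (row ∷ rest) r c
  go (just x) e zero    = sym e
  go (just x) e (suc r) = at-column rest (Linked.tail L) c r
  go nothing  e r       = trans (at-column rest (Linked.tail L) c r)
    (trans (below-first {suc r} row≤c) (sym (below-first {r} row≤c)))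
    where row≤c = at≡nothing⇒≥ row c e

column-length : ∀ τ c → length (column τ c) ≤ length τ
column-length τ c =
  ≤-trans (length-catMaybes (map (λ row → at row c) τ)) (≤-reflexive (length-map _ τ))

column-length≤⇔ : ∀ τ → Linked _≥_ (shape τ) → ∀ c r →
                  length (column τ c) ≤ r ⇔ length (rowOf τ r) ≤ c
column-length≤⇔ τ antitone c r = mk⇔
  (λ col≤r → at≡nothing⇒≥ (rowOf τ r) c (trans (sym column≡entry) (at-≥ (column τ c) col≤r)))
  (λ row≤c → at≡nothing⇒≥ (column τ c) r (trans column≡entry (at-≥ (rowOf τ r) row≤c)))
  where column≡entry = at-column τ antitone c r

column-count : ∀ τ → Linked _≥_ (shape τ) → ∀ c v →
  count (Copies (λ r → entry τ r c) v) (upTo (length τ)) ≡ count (_≡ᵇ v) (column τ c)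
column-count τ antitone c v = trans
  (count-cong _ _ (upTo (length τ)) λ r _ →
     cong (λ m → isJust≡ m (just v)) (sym (at-column τ antitone c r)))
  (count-at v (column τ c) (column-length τ c))

shape-stRows : ∀ σ k rows → shape (stRows σ k rows) ≡ shape rows
shape-stRows σ k []           = refl
shape-stRows σ k (row ∷ rows) =
  cong₂ _∷_ (trans (length-map _ (upTo (length row))) (length-upTo (length row)))
            (shape-stRows σ (suc k) rows)

entry-stRows : ∀ σ k rows {r c} → c < length (rowOf rows r) →
  entry (stRows σ k rows) r c ≡ just (fromMaybe 0 (at (sort (column σ c)) (k + r)))
entry-stRows σ k (row ∷ rows) {zero} {c} c<ℓ rewrite +-identityʳ k =
  trans (cong (λ xs → at xs c) (map-upTo _ (length row))) (at-applyUpTo _ c<ℓ)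
entry-stRows σ k (row ∷ rows) {suc r} c<ℓ rewrite +-suc k r = entry-stRows σ (suc k) rows c<ℓ

column-st : ∀ τ → Linked _≥_ (shape τ) → ∀ c → column (st τ) c ≡ sort (column τ c)
column-st τ antitone c = at-ext _ _ λ r →
  trans (at-column (st τ) (subst (Linked _≥_) (sym (shape-stRows τ 0 τ)) antitone) c r) (cell r)
  where
  open Equivalence
  sorted = sort (column τ c)
  sorted-length : length sorted ≡ length (column τ c)
  sorted-length = ↭-length (sort-↭ (column τ c))
  cell : ∀ r → entry (st τ) r c ≡ at sorted r
  cell r with c <? length (rowOf τ r)
  ... | yes c<ℓ = trans (entry-stRows τ 0 τ c<ℓ) (at-fromMaybe sorted (≰⇒> λ sorted≤r →
        <⇒≱ c<ℓ (to (column-length≤⇔ τ antitone c r) (subst (_≤ r) sorted-length sorted≤r))))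
  ... | no c≮ℓ  = trans
        (at-≥ (rowOf (st τ) r)
          (subst (_≤ c) (sym (rowOf-length-≡ (shape-stRows τ 0 τ) r)) (≮⇒≥ c≮ℓ)))
        (sym (at-≥ sorted (subst (_≤ r) (sym sorted-length)
                            (from (column-length≤⇔ τ antitone c r) (≮⇒≥ c≮ℓ)))))

column-↭ : ∀ {τ τ′} → Linked _≥_ (shape τ) → Linked _≥_ (shape τ′) → st τ ≡ st τ′ →
           ∀ c → column τ c ↭ column τ′ c
column-↭ {τ} {τ′} antitone antitone′ same-st c =
  ↭-trans (↭-sym (sort-↭ (column τ c))) (↭-trans (↭-reflexive same-sorted) (sort-↭ (column τ′ c)))
  where
  open ≡-Reasoning
  same-sorted : sort (column τ c) ≡ sort (column τ′ c)
  same-sorted = begin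
    sort (column τ c)   ≡⟨ column-st τ antitone c ⟨
    column (st τ) c     ≡⟨ cong (λ σ → column σ c) same-st ⟩
    column (st τ′) c    ≡⟨ column-st τ′ antitone′ c ⟩
    sort (column τ′ c)  ∎

module SameStandardization {τ τ′ : Filling}
  (antitone : Linked _≥_ (shape τ)) (same-shape : shape τ ≡ shape τ′) (same-st : st τ ≡ st τ′)
  (same-inversions : ∀ c i r j s → ESIP τ c i r j s ⇔ ESIP τ′ c i r j s) where

  open Equivalence

  antitone′ : Linked _≥_ (shape τ′)
  antitone′ = subst (Linked _≥_) same-shape antitone

  same-length : length τ ≡ length τ′
  same-length = length-≡ same-shape

  same-support : ∀ c r → entry τ r c ≡ nothing ⇔ entry τ′ r c ≡ nothing
  same-support c r = mk⇔ (at≡nothing-resp-length (rowOf τ r) (rowOf τ′ r) c row-length)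
                         (at≡nothing-resp-length (rowOf τ′ r) (rowOf τ r) c (sym row-length))
    where row-length = rowOf-length-≡ same-shape r

  ColumnAgrees : ℕ → Set
  ColumnAgrees c = ∀ r → entry τ r c ≡ entry τ′ r c

  beyond-first-row : ∀ c → length (rowOf τ 0) ≤ c → ColumnAgrees c
  beyond-first-row c first≤c r = trans nothing-in-τ (sym (to (same-support c r) nothing-in-τ))
    where
    nothing-in-τ : entry τ r c ≡ nothing
    nothing-in-τ = at-≥ (rowOf τ r) (≤-trans (rowLength-antitone τ antitone z≤n) first≤c)

  column-agrees : ∀ c → (∀ c′ → c < c′ → ColumnAgrees c′) → ColumnAgrees c
  column-agrees c right-agrees =
    column-determined (entry-just⇒< τ) (same-support c) same-count same-column-inversions
    where
    open HeightOrder τ antitone c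
    open RowOrder (length τ) (heightLt τ c) heightLt-trans heightLt-irrefl heightLt-total

    same-height : ∀ x y → heightLt τ c x y ≡ heightLt τ′ c x y
    same-height = heightLt-cong τ τ′ c λ r →
      drop-≡ (suc c) (rowOf τ r) (rowOf τ′ r) λ m → right-agrees (suc c + m) (s≤s (m≤m+n c m)) r

    f g : ℕ → Maybe ℕ
    f r = entry τ r c
    g r = entry τ′ r c

    same-count : ∀ v → count (Copies f v) (upTo (length τ)) ≡ count (Copies g v) (upTo (length τ))
    same-count v = begin
      count (Copies f v) (upTo (length τ))   ≡⟨ column-count τ antitone c v ⟩
      count (_≡ᵇ v) (column τ c)             ≡⟨ count-↭ _ (column-↭ antitone antitone′ same-st c) ⟩
      count (_≡ᵇ v) (column τ′ c)            ≡⟨ column-count τ′ antitone′ c v ⟨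
      count (Copies g v) (upTo (length τ′))  ≡⟨ cong (λ n → count _ (upTo n)) same-length ⟨
      count (Copies g v) (upTo (length τ))   ∎
      where open ≡-Reasoning

    same-column-inversions : ∀ i r j s → Inversion f i r j s ⇔ Inversion g i r j s
    same-column-inversions i r j s = mk⇔
      (ColumnInversion-resp g (sym same-length) (λ x y → sym (same-height x y))
        ∘ to (same-inversions c i r j s))
      (from (same-inversions c i r j s) ∘ ColumnInversion-resp g same-length same-height)

  filling-≡ : τ ≡ τ′
  filling-≡ = filling-ext same-length λ r c →
    downward-induction ColumnAgrees (length (rowOf τ 0)) beyond-first-row column-agrees c r

mainTheorem6 : (λ′ μ : List ℕ) (T τ τ′ : Filling) →
    IsPartition λ′ →
    IsSSYT T → shape T ≡ λ′ → HasContent T μ →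
    RowStandard τ → shape τ ≡ λ′ → HasContent τ μ →
    RowStandard τ′ → shape τ′ ≡ λ′ → HasContent τ′ μ →
    st τ ≡ T → st τ′ ≡ T →
    (∀ c i r j s → ESIP τ c i r j s ⇔ ESIP τ′ c i r j s) →
    τ ≡ τ′
mainTheorem6 _ _ _ τ τ′ (_ , λ′-antitone) _ _ _ _ shape-τ _ _ shape-τ′ _ st-τ st-τ′ same-inversions =
  SameStandardization.filling-≡ (subst (Linked _≥_) (sym shape-τ) λ′-antitone)
    (trans shape-τ (sym shape-τ′)) (trans st-τ (sym st-τ′)) same-inversions
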